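{- Let $p$ be a prime and $r\ge 1$. Let $A:\mathbb{F}_{p^r}\to\mathbb{F}_{p^r}$ be an Alltop function, let $\Pi(x)\in\mathbb{F}_{p^r}[x]$ be a Dembowski–Ostrom polynomial which is a planar function, let $L(x)\in\mathbb{F}_{p^r}[x]$ be an additive polynomial, and let $c\in\mathbb{F}_{p^r}$. Then $A'(x)=A(x)+\Pi(x)+L(x)+c$ is also an Alltop function.
   Context: For $f:\mathbb{F}_{p^r}\to\mathbb{F}_{p^r}$ and $a\in\mathbb{F}_{p^r}$ put $\Delta_{f,a}(x)=f(x+a)-f(x)$. A function $f$ is planar if $\Delta_{f,a}$ is a bijection of $\mathbb{F}_{p^r}$ for every $a\in\mathbb{F}_{p^r}^*$. A function $A$ is an Alltop function if $\Delta_{A,a}$ is a planar function for every $a\in\mathbb{F}_{p^r}^*$. A polynomial $L$ is additive if $L(x+y)=L(x)+L(y)$ for all $x,y\in\mathbb{F}_{p^r}$ (equivalently $L(x)=\sum_{k=0}^{r-1}a_kx^{p^k}$). A Dembowski–Ostrom polynomial is one of the form $\sum_{i,j=0}^{r-1}a_{ij}x^{p^i+p^j}$ with $a_{ij}\in\mathbb{F}_{p^r}$. -}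

module Defs where

open import Level using (Level) renaming (suc to lsuc)
open import Data.Nat using (ℕ; zero; suc; _^_) renaming (_+_ to _+ℕ_)
open import Data.Fin using (Fin; zero; suc; toℕ)
open import Data.Product using (Σ; ∃; _×_)
open import Relation.Nullary using (¬_)
open import Relation.Binary.PropositionalEquality using (_≡_; setoid)
open import Algebra.Structures using (IsCommutativeRing)
open import Function.Definitions using (Bijective)
open import Function.Bundles using (_↔_)

times : ∀ {c} {C : Set c} → (C → C → C) → C → ℕ → C → C
times _+_ z zero x = z
times _+_ z (suc n) x = x + times _+_ z n x

record FiniteField (p r : ℕ) (c : Level) : Set (lsuc c) where
  infixl 6 _+_ _-_
  infixl 7 _*_
  field
    Carrier : Set c
    _+_ _*_ : Carrier → Carrier → Carrier
    -_      : Carrier → Carrier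
    0# 1#   : Carrier
    isCommutativeRing : IsCommutativeRing _≡_ _+_ _*_ -_ 0# 1#
    nontrivial : ¬ (1# ≡ 0#)
    inverse : ∀ x → ¬ (x ≡ 0#) → Σ Carrier (λ y → x * y ≡ 1#)
    enumeration : Carrier ↔ Fin (p ^ r)
    -- characteristic p (automatic for a field with p^r elements, p prime)
    characteristic : times _+_ 0# p 1# ≡ 0#

  _-_ : Carrier → Carrier → Carrier
  x - y = x + (- y)


  _^ᶠ_ : Carrier → ℕ → Carrier
  x ^ᶠ zero = 1#
  x ^ᶠ suc n = x * (x ^ᶠ n)

  sumFin : (n : ℕ) → (Fin n → Carrier) → Carrier
  sumFin zero f = 0#
  sumFin (suc n) f = f zero + sumFin n (λ i → f (suc i))

  Δ : (Carrier → Carrier) → Carrier → Carrier → Carrier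
  Δ f a x = f (x + a) - f x

  Planar : (Carrier → Carrier) → Set c
  Planar f = ∀ a → ¬ (a ≡ 0#) → Bijective _≡_ _≡_ (Δ f a)

  Alltop : (Carrier → Carrier) → Set c
  Alltop A = ∀ a → ¬ (a ≡ 0#) → Planar (Δ A a)

  Additive : (Carrier → Carrier) → Set c
  Additive L = ∀ x y → L (x + y) ≡ L x + L y

  DembowskiOstrom : (Carrier → Carrier) → Set c
  DembowskiOstrom f =
    Σ (Fin r → Fin r → Carrier) λ a →
      ∀ x → f x ≡ sumFin r (λ i → sumFin r (λ j → a i j * (x ^ᶠ ((p ^ toℕ i) +ℕ (p ^ toℕ j)))))

-- Adding Π + L + k to A changes every second difference Δ_b Δ_a by a quantity
-- independent of x, and a translate of a bijection is a bijection, so each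
-- Δ_b Δ_a A' stays bijective. The second differences of the constant k vanish,
-- those of the additive L vanish, and Π is a sum of terms k F₁(x) F₂(x) with F₁, F₂
-- Frobenius powers x ↦ x^(p^i), which are additive because p divides every inner
-- binomial coefficient of (x + y)^p; for such a term Δ_a is an additive map plus
-- a constant, so Δ_b Δ_a is constant.
module Submission where

open import Defs

open import Level using (Level)
open import Data.Nat.Base as ℕ using (ℕ; zero; suc; _<_; _≤_; s≤s; z≤n)
open import Data.Nat.Properties as ℕ using (<⇒≱)
open import Data.Nat.Combinatorics using (_C_; nC1≡n; nCn≡1; nCk+nC[k+1]≡[n+1]C[k+1])
open import Data.Nat.Divisibility using (_∣_; divides; ∣⇒≤)
open import Data.Nat.Primality using (Prime; euclidsLemma; prime⇒nonZero)
open import Data.Fin.Base using (Fin; zero; suc; toℕ; fromℕ; inject₁)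
import Data.Fin.Properties as Fin
open import Data.Vec.Functional using (init; last; tail)
open import Data.Maybe.Base using (nothing)
open import Data.Sum using (inj₁; inj₂)
open import Data.Product using (_,_; ∃)
open import Data.Empty using (⊥-elim)
open import Function.Definitions using (Bijective)
open import Relation.Binary.PropositionalEquality as ≡ using (_≡_; refl; cong; cong₂; module ≡-Reasoning)
open import Algebra.Bundles using (CommutativeSemiring; CommutativeRing)
open import Tactic.RingSolver.Core.AlmostCommutativeRing using (fromCommutativeRing)

[1+k]*[1+n]C[1+k]≡[1+n]*nCk : ∀ n k → suc k ℕ.* (suc n C suc k) ≡ suc n ℕ.* (n C k)
[1+k]*[1+n]C[1+k]≡[1+n]*nCk zero    zero    = refl
[1+k]*[1+n]C[1+k]≡[1+n]*nCk zero    (suc k) = ℕ.*-zeroʳ (suc (suc k))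
[1+k]*[1+n]C[1+k]≡[1+n]*nCk (suc n) zero    = begin
  1 ℕ.* (suc (suc n) C 1) ≡⟨ ℕ.*-identityˡ _ ⟩
  suc (suc n) C 1         ≡⟨ nC1≡n (suc (suc n)) ⟩
  suc (suc n)             ≡⟨ ℕ.*-identityʳ _ ⟨
  suc (suc n) ℕ.* 1       ∎
  where open ≡-Reasoning
[1+k]*[1+n]C[1+k]≡[1+n]*nCk (suc n) (suc k) = begin
  suc (suc k) ℕ.* (suc (suc n) C suc (suc k))
    ≡⟨ cong (suc (suc k) ℕ.*_) (nCk+nC[k+1]≡[n+1]C[k+1] (suc n) (suc k)) ⟨
  suc (suc k) ℕ.* (X ℕ.+ Y)
    ≡⟨ ℕ.*-distribˡ-+ (suc (suc k)) X Y ⟩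
  (X ℕ.+ suc k ℕ.* X) ℕ.+ suc (suc k) ℕ.* Y
    ≡⟨ cong₂ (λ u v → (X ℕ.+ u) ℕ.+ v) ([1+k]*[1+n]C[1+k]≡[1+n]*nCk n k) ([1+k]*[1+n]C[1+k]≡[1+n]*nCk n (suc k)) ⟩
  (X ℕ.+ suc n ℕ.* (n C k)) ℕ.+ suc n ℕ.* (n C suc k)
    ≡⟨ ℕ.+-assoc X _ _ ⟩
  X ℕ.+ (suc n ℕ.* (n C k) ℕ.+ suc n ℕ.* (n C suc k))
    ≡⟨ cong (X ℕ.+_) (ℕ.*-distribˡ-+ (suc n) (n C k) (n C suc k)) ⟨
  X ℕ.+ suc n ℕ.* (n C k ℕ.+ n C suc k)
    ≡⟨ cong (λ u → X ℕ.+ suc n ℕ.* u) (nCk+nC[k+1]≡[n+1]C[k+1] n k) ⟩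
  suc (suc n) ℕ.* X ∎
  where
  open ≡-Reasoning
  X = suc n C suc k
  Y = suc n C suc (suc k)

p∣pCk : ∀ {p k} → Prime p → 0 < k → k < p → p ∣ p C k
p∣pCk {suc n} {suc k} p-prime _ k<p
  with euclidsLemma (suc k) (suc n C suc k) p-prime
         (divides (n C k) (≡.trans ([1+k]*[1+n]C[1+k]≡[1+n]*nCk n k) (ℕ.*-comm (suc n) (n C k))))
... | inj₁ p∣k   = ⊥-elim (<⇒≱ k<p (∣⇒≤ p∣k))
... | inj₂ p∣pCk = p∣pCk

module Frobenius {a ℓ} (S : CommutativeSemiring a ℓ) where
  open CommutativeSemiring S hiding (zero)
  open import Algebra.Properties.Semiring.Mult semiring using (_×_; ×-assoc-*; ×1-homo-*)
  open import Algebra.Properties.Monoid.Mult +-monoid using (×-congʳ)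
  open import Algebra.Properties.Semiring.Exp semiring using (_^_; ^-congˡ; ^-assocʳ)
  open import Algebra.Properties.Monoid.Sum +-monoid using (sum; sum-init-last; sum-cong-≋; sum-replicate-zero)
  open import Algebra.Properties.CommutativeSemiring.Binomial S using (theorem; binomialTerm)
  open import Relation.Binary.Reasoning.Setoid setoid

  module _ {p} (p-prime : Prime p) (char-p : p × 1# ≈ 0#) where

    p∣m⇒m×x≈0 : ∀ {m} x → p ∣ m → m × x ≈ 0#
    p∣m⇒m×x≈0 x (divides q refl) = begin
      (q ℕ.* p) × x          ≈⟨ ×-congʳ (q ℕ.* p) (*-identityˡ x) ⟨
      (q ℕ.* p) × (1# * x)   ≈⟨ ×-assoc-* (q ℕ.* p) 1# x ⟨
      ((q ℕ.* p) × 1#) * x   ≈⟨ *-congʳ (×1-homo-* q p) ⟩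
      (q × 1#) * (p × 1#) * x ≈⟨ *-congʳ (*-congˡ char-p) ⟩
      (q × 1#) * 0# * x      ≈⟨ *-congʳ (zeroʳ _) ⟩
      0# * x                 ≈⟨ zeroˡ x ⟩
      0#                     ∎

    binomialTerm-inner≈0 : ∀ {n} → p ≡ suc n → ∀ x y (i : Fin n) → init (tail (binomialTerm x y (suc n))) i ≈ 0#
    binomialTerm-inner≈0 {n} refl x y i = p∣m⇒m×x≈0 _ (p∣pCk p-prime (s≤s z≤n) (s≤s i<n))
      where
      i<n : toℕ (inject₁ i) < n
      i<n = ℕ.≤-trans (ℕ.≤-reflexive (cong suc (Fin.toℕ-inject₁ i))) (Fin.toℕ<n i)

    binomialTerm-last : ∀ n x y → last (binomialTerm x y n) ≈ x ^ n
    binomialTerm-last n x y = begin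
      (n C toℕ (fromℕ n)) × (x ^ toℕ (fromℕ n) * y ^ (n ℕ.∸ toℕ (fromℕ n)))
        ≡⟨ cong (λ k → (n C k) × (x ^ k * y ^ (n ℕ.∸ k))) (Fin.toℕ-fromℕ n) ⟩
      (n C n) × (x ^ n * y ^ (n ℕ.∸ n))
        ≡⟨ cong₂ (λ c k → c × (x ^ n * y ^ k)) (nCn≡1 n) (ℕ.n∸n≡0 n) ⟩
      x ^ n * 1# + 0#  ≈⟨ +-identityʳ _ ⟩
      x ^ n * 1#       ≈⟨ *-identityʳ _ ⟩
      x ^ n            ∎

    ^-p-distrib-+ : ∀ x y → (x + y) ^ p ≈ x ^ p + y ^ p
    ^-p-distrib-+ = expansion (≡.sym (ℕ.suc-pred p ⦃ prime⇒nonZero p-prime ⦄))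
      where
      expansion : ∀ {n} → p ≡ suc n → ∀ x y → (x + y) ^ p ≈ x ^ p + y ^ p
      expansion {n} p≡1+n@refl x y = begin
        (x + y) ^ suc n                            ≈⟨ theorem (suc n) x y ⟩
        t zero + sum (tail t)                      ≈⟨ +-congˡ (sum-init-last (tail t)) ⟩
        t zero + (sum (init (tail t)) + last t)    ≈⟨ +-congˡ (+-cong inner≈0 (binomialTerm-last (suc n) x y)) ⟩
        t zero + (0# + x ^ suc n)                  ≈⟨ +-cong (+-identityʳ _) (+-identityˡ _) ⟩
        1# * y ^ suc n + x ^ suc n                 ≈⟨ +-congʳ (*-identityˡ _) ⟩
        y ^ suc n + x ^ suc n                      ≈⟨ +-comm _ _ ⟩
        x ^ suc n + y ^ suc n                      ∎
        where
        t = binomialTerm x y (suc n)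
        inner≈0 : sum (init (tail t)) ≈ 0#
        inner≈0 = trans (sum-cong-≋ (binomialTerm-inner≈0 p≡1+n x y)) (sum-replicate-zero n)

    ^-p^i-distrib-+ : ∀ i x y → (x + y) ^ (p ℕ.^ i) ≈ x ^ (p ℕ.^ i) + y ^ (p ℕ.^ i)
    ^-p^i-distrib-+ zero    x y = distribʳ 1# x y
    ^-p^i-distrib-+ (suc i) x y = begin
      (x + y) ^ (p ℕ.* q)          ≈⟨ ^-assocʳ (x + y) p q ⟨
      ((x + y) ^ p) ^ q            ≈⟨ ^-congˡ q (^-p-distrib-+ x y) ⟩
      (x ^ p + y ^ p) ^ q          ≈⟨ ^-p^i-distrib-+ i (x ^ p) (y ^ p) ⟩
      (x ^ p) ^ q + (y ^ p) ^ q    ≈⟨ +-cong (^-assocʳ x p q) (^-assocʳ y p q) ⟩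
      x ^ (p ℕ.* q) + y ^ (p ℕ.* q) ∎
      where q = p ℕ.^ i

module _ {c p r} (F : FiniteField p r c) where
  open FiniteField F

  commutativeRing : CommutativeRing c c
  commutativeRing = record { isCommutativeRing = isCommutativeRing }

  open CommutativeRing commutativeRing
    using (commutativeSemiring; semiring; +-abelianGroup; +-commutativeSemigroup)
  open import Algebra.Properties.AbelianGroup +-abelianGroup using (xyx⁻¹≈y; ⁻¹-∙-comm; ∙-cancelʳ; //-rightDividesˡ)
  open import Algebra.Properties.CommutativeSemigroup +-commutativeSemigroup using (interchange)
  open import Algebra.Properties.Semiring.Mult semiring using (_×_)
  open import Algebra.Properties.Semiring.Exp semiring using (_^_; ^-homo-*)
  open import Tactic.RingSolver.NonReflective (fromCommutativeRing commutativeRing (λ _ → nothing))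
  open ≡-Reasoning

  times≡× : ∀ n x → times _+_ 0# n x ≡ n × x
  times≡× zero    x = refl
  times≡× (suc n) x = cong (x +_) (times≡× n x)

  ^ᶠ≡^ : ∀ x n → x ^ᶠ n ≡ x ^ n
  ^ᶠ≡^ x zero    = refl
  ^ᶠ≡^ x (suc n) = cong (x *_) (^ᶠ≡^ x n)

  ^ᶠ-homo-* : ∀ x m n → x ^ᶠ (m ℕ.+ n) ≡ x ^ᶠ m * x ^ᶠ n
  ^ᶠ-homo-* x m n = begin
    x ^ᶠ (m ℕ.+ n)    ≡⟨ ^ᶠ≡^ x (m ℕ.+ n) ⟩
    x ^ (m ℕ.+ n)     ≡⟨ ^-homo-* x m n ⟩
    x ^ m * x ^ n     ≡⟨ cong₂ _*_ (^ᶠ≡^ x m) (^ᶠ≡^ x n) ⟨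
    x ^ᶠ m * x ^ᶠ n   ∎

  additive-^p^i : Prime p → ∀ i → Additive (_^ᶠ (p ℕ.^ i))
  additive-^p^i p-prime i x y = begin
    (x + y) ^ᶠ q          ≡⟨ ^ᶠ≡^ (x + y) q ⟩
    (x + y) ^ q           ≡⟨ Frobenius.^-p^i-distrib-+ commutativeSemiring p-prime char-p i x y ⟩
    x ^ q + y ^ q         ≡⟨ cong₂ _+_ (^ᶠ≡^ x q) (^ᶠ≡^ y q) ⟨
    x ^ᶠ q + y ^ᶠ q       ∎
    where
    q = p ℕ.^ i
    char-p : p × 1# ≡ 0#
    char-p = ≡.trans (≡.sym (times≡× p 1#)) characteristic

  Δ-cong : ∀ {f g : Carrier → Carrier} → (∀ x → f x ≡ g x) → ∀ a x → Δ f a x ≡ Δ g a x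
  Δ-cong f≗g a x = cong₂ _-_ (f≗g (x + a)) (f≗g x)

  Δ-homo-+ : ∀ {f g h : Carrier → Carrier} → (∀ x → h x ≡ f x + g x) →
             ∀ a x → Δ h a x ≡ Δ f a x + Δ g a x
  Δ-homo-+ {f} {g} {h} h≗f+g a x = begin
    h (x + a) - h x                         ≡⟨ Δ-cong h≗f+g a x ⟩
    (f (x + a) + g (x + a)) - (f x + g x)   ≡⟨ cong ((f (x + a) + g (x + a)) +_) (⁻¹-∙-comm (f x) (g x)) ⟨
    (f (x + a) + g (x + a)) + (- f x - g x) ≡⟨ interchange _ _ _ _ ⟩
    Δ f a x + Δ g a x                       ∎

  Δ-additive : ∀ {L : Carrier → Carrier} → Additive L → ∀ a x → Δ L a x ≡ L a
  Δ-additive {L} L-additive a x = ≡.trans (cong (_- L x) (L-additive x a)) (xyx⁻¹≈y (L x) (L a))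

  ConstantΔ : (Carrier → Carrier) → Set c
  ConstantΔ g = ∀ a x → Δ g a x ≡ Δ g a 0#

  ConstantΔ² : (Carrier → Carrier) → Set c
  ConstantΔ² f = ∀ a → ConstantΔ (Δ f a)

  constantΔ-const : ∀ {g : Carrier → Carrier} {u} → (∀ x → g x ≡ u) → ConstantΔ g
  constantΔ-const g≗u a x = ≡.trans (Δ-cong g≗u a x) (≡.sym (Δ-cong g≗u a 0#))

  constantΔ-affine : ∀ {g B : Carrier → Carrier} {u} → Additive B → (∀ x → g x ≡ u + B x) → ConstantΔ g
  constantΔ-affine {g} {B} {u} B-additive g≗u+B a x = begin
    Δ g a x                     ≡⟨ Δ-homo-+ g≗u+B a x ⟩
    (u - u) + Δ B a x           ≡⟨ cong ((u - u) +_) (≡.trans (Δ-additive B-additive a x) (≡.sym (Δ-additive B-additive a 0#))) ⟩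
    (u - u) + Δ B a 0#          ≡⟨ Δ-homo-+ g≗u+B a 0# ⟨
    Δ g a 0#                    ∎

  constantΔ²-cong : ∀ {f g : Carrier → Carrier} → (∀ x → f x ≡ g x) → ConstantΔ² g → ConstantΔ² f
  constantΔ²-cong {f} {g} f≗g g-constant a b x = begin
    Δ (Δ f a) b x    ≡⟨ Δ-cong (Δ-cong f≗g a) b x ⟩
    Δ (Δ g a) b x    ≡⟨ g-constant a b x ⟩
    Δ (Δ g a) b 0#   ≡⟨ Δ-cong (Δ-cong f≗g a) b 0# ⟨
    Δ (Δ f a) b 0#   ∎

  constantΔ²-+ : ∀ {f g : Carrier → Carrier} → ConstantΔ² f → ConstantΔ² g → ConstantΔ² (λ x → f x + g x)
  constantΔ²-+ {f} {g} f-constant g-constant a b x = begin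
    Δ (Δ f+g a) b x                   ≡⟨ Δ²-homo-+ x ⟩
    Δ (Δ f a) b x + Δ (Δ g a) b x     ≡⟨ cong₂ _+_ (f-constant a b x) (g-constant a b x) ⟩
    Δ (Δ f a) b 0# + Δ (Δ g a) b 0#   ≡⟨ Δ²-homo-+ 0# ⟨
    Δ (Δ f+g a) b 0#                  ∎
    where
    f+g = λ x → f x + g x
    Δ²-homo-+ : ∀ x → Δ (Δ f+g a) b x ≡ Δ (Δ f a) b x + Δ (Δ g a) b x
    Δ²-homo-+ = Δ-homo-+ (Δ-homo-+ (λ _ → refl) a) b

  constantΔ²-sumFin : ∀ n {h : Fin n → Carrier → Carrier} →
                      (∀ i → ConstantΔ² (h i)) → ConstantΔ² (λ x → sumFin n (λ i → h i x))
  constantΔ²-sumFin zero    _          _ _ _ = refl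
  constantΔ²-sumFin (suc n) h-constant =
    constantΔ²-+ (h-constant zero) (constantΔ²-sumFin n (λ i → h-constant (suc i)))

  constantΔ²-additive : ∀ {L : Carrier → Carrier} → Additive L → ConstantΔ² L
  constantΔ²-additive L-additive a = constantΔ-const (Δ-additive L-additive a)

  constantΔ²-bilinear : ∀ {F₁ F₂ : Carrier → Carrier} → Additive F₁ → Additive F₂ → ∀ k →
                        ConstantΔ² (λ x → k * (F₁ x * F₂ x))
  constantΔ²-bilinear {F₁} {F₂} F₁-additive F₂-additive k a =
    constantΔ-affine polar-additive Δ-quadratic
    where
    P polar : Carrier → Carrier
    P x = k * (F₁ x * F₂ x)
    polar x = k * (F₁ x * F₂ a + F₁ a * F₂ x)

    polar-additive : Additive polar
    polar-additive x y = ≡.trans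
      (cong₂ (λ u v → k * (u * F₂ a + F₁ a * v)) (F₁-additive x y) (F₂-additive x y))
      (solve 7 (λ k X Y A X' Y' A' →
          k ⊗ ((X ⊕ Y) ⊗ A' ⊕ A ⊗ (X' ⊕ Y')) ⊜ (k ⊗ (X ⊗ A' ⊕ A ⊗ X') ⊕ k ⊗ (Y ⊗ A' ⊕ A ⊗ Y')))
        refl k (F₁ x) (F₁ y) (F₁ a) (F₂ x) (F₂ y) (F₂ a))

    P-expand : ∀ x → P (x + a) ≡ P x + (P a + polar x)
    P-expand x = ≡.trans
      (cong₂ (λ u v → k * (u * v)) (F₁-additive x a) (F₂-additive x a))
      (solve 5 (λ k X A X' A' →
          k ⊗ ((X ⊕ A) ⊗ (X' ⊕ A')) ⊜ (k ⊗ (X ⊗ X') ⊕ (k ⊗ (A ⊗ A') ⊕ k ⊗ (X ⊗ A' ⊕ A ⊗ X'))))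
        refl k (F₁ x) (F₁ a) (F₂ x) (F₂ a))

    Δ-quadratic : ∀ x → Δ P a x ≡ P a + polar x
    Δ-quadratic x = ≡.trans (cong (_- P x) (P-expand x)) (xyx⁻¹≈y (P x) (P a + polar x))

  constantΔ²-dembowskiOstrom : Prime p → ∀ {Π : Carrier → Carrier} → DembowskiOstrom Π → ConstantΔ² Π
  constantΔ²-dembowskiOstrom p-prime (coeff , Π≗) =
    constantΔ²-cong Π≗ (constantΔ²-sumFin r λ i → constantΔ²-sumFin r λ j →
      constantΔ²-cong (λ x → cong (coeff i j *_) (^ᶠ-homo-* x (p ℕ.^ toℕ i) (p ℕ.^ toℕ j)))
        (constantΔ²-bilinear (additive-^p^i p-prime (toℕ i)) (additive-^p^i p-prime (toℕ j)) (coeff i j)))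

  bijective-translate : ∀ {g h : Carrier → Carrier} {t} →
                        Bijective _≡_ _≡_ h → (∀ x → g x ≡ h x + t) → Bijective _≡_ _≡_ g
  bijective-translate {g} {h} {t} (h-injective , h-surjective) g≗h+t = g-injective , g-surjective
    where
    g-injective : ∀ {x y} → g x ≡ g y → x ≡ y
    g-injective {x} {y} gx≡gy =
      h-injective (∙-cancelʳ t (h x) (h y) (≡.trans (≡.sym (g≗h+t x)) (≡.trans gx≡gy (g≗h+t y))))

    g-surjective : ∀ y → ∃ λ x → ∀ {z} → z ≡ x → g z ≡ y
    g-surjective y with h-surjective (y - t)
    ... | x , hx≡y-t = x , λ {z} z≡x → ≡.trans (g≗h+t z) (≡.trans (cong (_+ t) (hx≡y-t z≡x)) (//-rightDividesˡ t y))

  planar-+ : ∀ {f g h : Carrier → Carrier} → Planar f → ConstantΔ g → (∀ x → h x ≡ f x + g x) → Planar h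
  planar-+ {f} {g} f-planar g-constant h≗f+g a a≢0 =
    bijective-translate (f-planar a a≢0)
      (λ x → ≡.trans (Δ-homo-+ h≗f+g a x) (cong (Δ f a x +_) (g-constant a x)))

  alltop-+ : ∀ {A g : Carrier → Carrier} → Alltop A → ConstantΔ² g → Alltop (λ x → A x + g x)
  alltop-+ A-alltop g-constant a a≢0 =
    planar-+ (A-alltop a a≢0) (g-constant a) (Δ-homo-+ (λ _ → refl) a)

lemma2 : ∀ {c : Level} (p r : ℕ) → Prime p → 1 ≤ r → (F : FiniteField p r c) →
    let open FiniteField F in
    (A Π L : Carrier → Carrier) (k : Carrier) →
    Alltop A → DembowskiOstrom Π → Planar Π → Additive L →
    Alltop (λ x → A x + Π x + L x + k)
lemma2 p r p-prime _ F A Π L k A-alltop Π-dembowskiOstrom _ L-additive =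
  alltop-+ F (alltop-+ F (alltop-+ F A-alltop Π-constantΔ²) L-constantΔ²) k-constantΔ²
  where
  open FiniteField F using (Carrier)
  Π-constantΔ² : ConstantΔ² F Π
  Π-constantΔ² = constantΔ²-dembowskiOstrom F p-prime Π-dembowskiOstrom
  L-constantΔ² : ConstantΔ² F L
  L-constantΔ² = constantΔ²-additive F L-additive
  k-constantΔ² : ConstantΔ² F (λ (_ : Carrier) → k)
  k-constantΔ² _ _ _ = refl
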